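{- For natural numbers $n,M>0$, $spt^{*}_M(n)>spt^{ - }_M(n)$.
   Context: $spt^{*}_M(n)$ is the total number of appearances of the smallest part, summed over all partitions of $n$ in which no part exceeds the smallest part plus $M$. $spt^{ - }_M(n)$ is defined by the generating function $$\sum_{n\ge1}spt^{ - }_M(n)q^n=\sum_{k\ge1}\frac{q^{kM+k}}{(1-q^{k})^2(1-q^{k+1})\cdots(1-q^{k+M})}.$$ (Combinatorially, $spt^{ - }_M(n)$ counts, over partitions of $n$ whose parts are at most the smallest part plus $M$ and whose smallest part appears at least $M$ times, the number of appearances of the smallest part beyond the first $M$.) -}

module Defs where

open import Data.Nat using (ℕ; zero; suc; _+_; _*_; _∸_; _≤ᵇ_; _≡ᵇ_; _%_)
open import Data.List using (List; []; _∷_; _++_; map)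
open import Data.Nat.ListAction using (sum)
open import Data.Bool using (if_then_else_)

-- Partitions are represented as non-increasing lists of positive parts.
-- partsGo fuel n m : all non-increasing lists of positive naturals,
-- each part ≤ m, summing to n (fuel ≥ n + m + 1 suffices).
partsGo : ℕ → ℕ → ℕ → List (List ℕ)
partsGo zero    _       _       = []
partsGo (suc f) zero    _       = [] ∷ []
partsGo (suc f) (suc n) zero    = []
partsGo (suc f) (suc n) (suc m) =
  partsGo f (suc n) m
  ++ (if suc m ≤ᵇ suc n
      then map (suc m ∷_) (partsGo f (suc n ∸ suc m) (suc m))
      else [])

partitions : ℕ → List (List ℕ)
partitions n = partsGo (suc (n + n)) n n

-- largest part (head of a non-increasing list); 0 for the empty partition
largest : List ℕ → ℕ
largest []      = 0
largest (x ∷ _) = x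

-- smallest part (last entry of a non-increasing list); 0 for the empty partition
smallest : List ℕ → ℕ
smallest []          = 0
smallest (x ∷ [])    = x
smallest (x ∷ y ∷ l) = smallest (y ∷ l)

count : ℕ → List ℕ → ℕ
count a []      = 0
count a (x ∷ l) = (if a ≡ᵇ x then 1 else 0) + count a l

sptStarTerm : ℕ → List ℕ → ℕ
sptStarTerm M λ' =
  if largest λ' ≤ᵇ smallest λ' + M then count (smallest λ') λ' else 0

sptStar : ℕ → ℕ → ℕ
sptStar M n = sum (map (sptStarTerm M) (partitions n))

Series : Set
Series = ℕ → ℕ

sumTo : ℕ → (ℕ → ℕ) → ℕ
sumTo zero    f = f 0
sumTo (suc n) f = sumTo n f + f (suc n)

sumFrom1 : ℕ → (ℕ → ℕ) → ℕ
sumFrom1 zero    f = 0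
sumFrom1 (suc n) f = sumFrom1 n f + f (suc n)

_⊛_ : Series → Series → Series
(f ⊛ g) n = sumTo n (λ i → f i * g (n ∸ i))

-- 1 / (1 - q^(j+1)) = Σ_r q^{r (j+1)}
geom : ℕ → Series
geom j n = if n % suc j ≡ᵇ 0 then 1 else 0

-- multiplication by q^a
shift : ℕ → Series → Series
shift a f n = if a ≤ᵇ n then f (n ∸ a) else 0

-- Π_{i=1}^{M} 1/(1 - q^{k+i})   (for k ≥ 1)
prodGeom : ℕ → ℕ → Series
prodGeom k zero    n = if n ≡ᵇ 0 then 1 else 0
prodGeom k (suc M) = prodGeom k M ⊛ geom (k + M)

-- the k-th summand  q^{kM+k} / ((1-q^k)^2 (1-q^{k+1}) ... (1-q^{k+M})),  k ≥ 1
sptMinusSummand : ℕ → ℕ → Series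
sptMinusSummand M zero    = λ _ → 0   -- unused (k starts at 1)
sptMinusSummand M (suc j) =
  shift (suc j * M + suc j) ((geom j ⊛ geom j) ⊛ prodGeom (suc j) M)

-- spt⁻_M(n) = coefficient of q^n in Σ_{k≥1} summand_k.
-- Summands with k > n have kM+k > n, hence vanish at q^n; so the sum
-- over 1 ≤ k ≤ n is the full coefficient.
sptMinus : ℕ → ℕ → ℕ
sptMinus M n = sumFrom1 n (λ k → sptMinusSummand M k n)

-- Grouping the partitions counted by spt*_M(n) by their smallest part k shows that spt*_M(n) is the
-- coefficient of q^n in Σ_k q^k K_k, where K_k = 1/((1 - q^k)^2 (1 - q^(k+1)) ⋯ (1 - q^(k+M))), while
-- spt⁻_M(n) is that of Σ_k q^(k(M+1)) K_k. One factor 1/(1 - q^k) makes the coefficients of K_k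
-- non-decreasing along steps of k, so each summand of spt⁻_M(n) is at most the matching summand of
-- spt*_M(n); for k = n the former is 0 and the latter is K_n(0) = 1.

{-# OPTIONS --safe #-}
module Submission where

open import Defs

open import Data.Bool using (Bool; true; false; T; if_then_else_; _∧_)
open import Data.Bool.ListAction using (all)
open import Data.Bool.Properties using (T-∧; T-≡; ∧-zeroʳ; ¬-not; if-float)
open import Data.List using (List; []; _∷_; _++_; map)
open import Data.List.Properties using (map-++; map-∘; map-cong; map-cong-local)
open import Data.List.Relation.Unary.All using (All; []; _∷_)
import Data.List.Relation.Unary.All as All
open import Data.List.Relation.Unary.All.Properties using (++⁺; map⁺; all⁺; all⁻)
open import Data.Nat using (ℕ; zero; suc; _+_; _*_; _∸_; _≤_; _<_; _>_; _≤ᵇ_; _≡ᵇ_; z≤n; s≤s; z<s)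
open import Data.Nat.DivMod using (m<n⇒m%n≡m; [m+n]%n≡m%n)
open import Data.Nat.Induction using (<-rec)
open import Data.Nat.ListAction using (sum)
open import Data.Nat.ListAction.Properties using (sum-++)
open import Data.Nat.Properties
open import Algebra.Properties.CommutativeSemigroup +-commutativeSemigroup using (interchange)
open import Data.Product using (_×_; _,_; proj₁; proj₂; map₂)
open import Data.Sum using (inj₁; inj₂)
open import Function using (_∘_; Equivalence)
open import Relation.Binary.Definitions using (tri<; tri≈; tri>)
open import Relation.Binary.PropositionalEquality
open import Relation.Nullary using (yes; no; contradiction)
open import Relation.Nullary.Reflects using (Reflects; ofʸ; ofⁿ; det; fromEquivalence)

≤ᵇ-true : ∀ {m n} → m ≤ n → (m ≤ᵇ n) ≡ true
≤ᵇ-true {m} {n} m≤n = det (≤ᵇ-reflects-≤ m n) (ofʸ m≤n)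

≤ᵇ-false : ∀ {m n} → n < m → (m ≤ᵇ n) ≡ false
≤ᵇ-false {m} {n} n<m = det (≤ᵇ-reflects-≤ m n) (ofⁿ (<⇒≱ n<m))

≡ᵇ-reflects-≡ : ∀ m n → Reflects (m ≡ n) (m ≡ᵇ n)
≡ᵇ-reflects-≡ m n = fromEquivalence (≡ᵇ⇒≡ m n) (≡⇒≡ᵇ m n)

≡ᵇ-refl : ∀ m → (m ≡ᵇ m) ≡ true
≡ᵇ-refl m = det (≡ᵇ-reflects-≡ m m) (ofʸ refl)

≡ᵇ-false : ∀ {m n} → m ≢ n → (m ≡ᵇ n) ≡ false
≡ᵇ-false {m} {n} m≢n = det (≡ᵇ-reflects-≡ m n) (ofⁿ m≢n)

if-distrib-+ : ∀ b {x y : ℕ} → (if b then x + y else 0) ≡ (if b then x else 0) + (if b then y else 0)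
if-distrib-+ true  = refl
if-distrib-+ false = refl

if-then-zero : ∀ b {x : ℕ} → x ≡ 0 → (if b then x else 0) ≡ 0
if-then-zero true  x≡0 = x≡0
if-then-zero false _   = refl

-- Power series

infixl 6 _⊕_

_⊕_ : Series → Series → Series
(F ⊕ G) r = F r + G r

one : Series
one n = if n ≡ᵇ 0 then 1 else 0

data ShiftView (m : ℕ) : ℕ → Set where
  below : ∀ {r} → r < m → ShiftView m r
  above : ∀ t → ShiftView m (t + m)

shiftView : ∀ m r → ShiftView m r
shiftView m r with m ≤? r
... | yes m≤r = subst (ShiftView m) (m∸n+n≡m m≤r) (above (r ∸ m))
... | no  m≰r = below (≰⇒> m≰r)

shift-below : ∀ {m r} (F : Series) → r < m → shift m F r ≡ 0
shift-below {m} {r} F r<m = cong (λ b → if b then F (r ∸ m) else 0) (≤ᵇ-false r<m)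

shift-above : ∀ m t (F : Series) → shift m F (t + m) ≡ F t
shift-above m t F = trans (cong (λ b → if b then F (t + m ∸ m) else 0) (≤ᵇ-true (m≤n+m m t))) (cong F (m+n∸n≡m t m))

shift-cong : ∀ m {F G : Series} → F ≗ G → shift m F ≗ shift m G
shift-cong m F≗G r = cong (λ x → if m ≤ᵇ r then x else 0) (F≗G (r ∸ m))

shift-zero : ∀ m {F : Series} → (∀ t → F t ≡ 0) → ∀ r → shift m F r ≡ 0
shift-zero m {F} F≗0 r with shiftView m r
... | below r<m = shift-below F r<m
... | above t   = trans (shift-above m t F) (F≗0 t)

shift-distrib-⊕ : ∀ m (F G : Series) → shift m (F ⊕ G) ≗ shift m F ⊕ shift m G
shift-distrib-⊕ m F G r with shiftView m r
... | below r<m = trans (shift-below (F ⊕ G) r<m) (sym (cong₂ _+_ (shift-below F r<m) (shift-below G r<m)))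
... | above t   = trans (shift-above m t (F ⊕ G)) (sym (cong₂ _+_ (shift-above m t F) (shift-above m t G)))

shift-shift : ∀ a b (F : Series) r → shift a (shift b F) r ≡ shift (b + a) F r
shift-shift a b F r with shiftView a r
... | below r<a = trans (shift-below (shift b F) r<a) (sym (shift-below F (<-≤-trans r<a (m≤n+m a b))))
... | above t with shiftView b t
...   | below t<b = trans (shift-above a t (shift b F)) (trans (shift-below F t<b) (sym (shift-below F (+-monoˡ-< a t<b))))
...   | above u   = begin
  shift a (shift b F) (u + b + a)  ≡⟨ shift-above a (u + b) (shift b F) ⟩
  shift b F (u + b)                ≡⟨ shift-above b u F ⟩
  F u                              ≡⟨ shift-above (b + a) u F ⟨
  shift (b + a) F (u + (b + a))    ≡⟨ cong (shift (b + a) F) (+-assoc u b a) ⟨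
  shift (b + a) F (u + b + a)      ∎
  where open ≡-Reasoning

shift-comm : ∀ a b (F : Series) r → shift a (shift b F) r ≡ shift b (shift a F) r
shift-comm a b F r = trans (shift-shift a b F r) (trans (cong (λ c → shift c F r) (+-comm b a)) (sym (shift-shift b a F r)))

sumTo-cong : ∀ n {f g : ℕ → ℕ} → (∀ {i} → i ≤ n → f i ≡ g i) → sumTo n f ≡ sumTo n g
sumTo-cong zero    f≡g = f≡g z≤n
sumTo-cong (suc n) f≡g = cong₂ _+_ (sumTo-cong n (λ i≤n → f≡g (m≤n⇒m≤1+n i≤n))) (f≡g ≤-refl)

sumTo-zero : ∀ n {f : ℕ → ℕ} → (∀ {i} → i ≤ n → f i ≡ 0) → sumTo n f ≡ 0
sumTo-zero zero    f≡0 = f≡0 z≤n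
sumTo-zero (suc n) f≡0 = cong₂ _+_ (sumTo-zero n (λ i≤n → f≡0 (m≤n⇒m≤1+n i≤n))) (f≡0 ≤-refl)

sumTo-distrib-+ : ∀ n (f g : ℕ → ℕ) → sumTo n (λ i → f i + g i) ≡ sumTo n f + sumTo n g
sumTo-distrib-+ zero    f g = refl
sumTo-distrib-+ (suc n) f g =
  trans (cong (_+ (f (suc n) + g (suc n))) (sumTo-distrib-+ n f g)) (interchange (sumTo n f) (sumTo n g) (f (suc n)) (g (suc n)))

sumTo-vanishing-tail : ∀ t {g : ℕ → ℕ} → (∀ {i} → t < i → g i ≡ 0) → ∀ e → sumTo (t + e) g ≡ sumTo t g
sumTo-vanishing-tail t {g} g≡0 zero    = cong (λ n → sumTo n g) (+-identityʳ t)
sumTo-vanishing-tail t {g} g≡0 (suc e) rewrite +-suc t e =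
  trans (cong₂ _+_ (sumTo-vanishing-tail t g≡0 e) (g≡0 (s≤s (m≤m+n t e)))) (+-identityʳ _)

sumTo-mono : ∀ n {f g : ℕ → ℕ} → (∀ i → f i ≤ g i) → sumTo n f ≤ sumTo n g
sumTo-mono zero    f≤g = f≤g 0
sumTo-mono (suc n) f≤g = +-mono-≤ (sumTo-mono n f≤g) (f≤g (suc n))

last-≤-sumTo : ∀ n (f : ℕ → ℕ) → f n ≤ sumTo n f
last-≤-sumTo zero    f = ≤-refl
last-≤-sumTo (suc n) f = m≤n+m (f (suc n)) (sumTo n f)

sumTo-reindex-≤ : ∀ m s (f : ℕ → ℕ) → sumTo s (λ i → f (i + m)) ≤ sumTo (s + m) f
sumTo-reindex-≤ m zero    f = last-≤-sumTo m f
sumTo-reindex-≤ m (suc s) f = +-monoˡ-≤ (f (suc s + m)) (sumTo-reindex-≤ m s f)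

⊛-identityʳ : ∀ (C : Series) → C ⊛ one ≗ C
⊛-identityʳ C zero    = *-identityʳ (C 0)
⊛-identityʳ C (suc r) = begin
  sumTo r (λ i → C i * one (suc r ∸ i)) + C (suc r) * one (r ∸ r)
    ≡⟨ cong₂ _+_ (sumTo-zero r off-diagonal) (cong (λ x → C (suc r) * one x) (n∸n≡0 r)) ⟩
  C (suc r) * 1                                                      ≡⟨ *-identityʳ (C (suc r)) ⟩
  C (suc r)                                                          ∎
  where
  open ≡-Reasoning
  off-diagonal : ∀ {i} → i ≤ r → C i * one (suc r ∸ i) ≡ 0
  off-diagonal {i} i≤r = trans (cong (λ x → C i * one x) (+-∸-assoc 1 i≤r)) (*-zeroʳ (C i))

⊛-congˡ : ∀ (C : Series) {G H : Series} → G ≗ H → C ⊛ G ≗ C ⊛ H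
⊛-congˡ C G≗H r = sumTo-cong r (λ {i} _ → cong (C i *_) (G≗H (r ∸ i)))

⊛-distribˡ-⊕ : ∀ (C G H : Series) → C ⊛ (G ⊕ H) ≗ C ⊛ G ⊕ C ⊛ H
⊛-distribˡ-⊕ C G H r =
  trans (sumTo-cong r (λ {i} _ → *-distribˡ-+ (C i) (G (r ∸ i)) (H (r ∸ i))))
        (sumTo-distrib-+ r (λ i → C i * G (r ∸ i)) (λ i → C i * H (r ∸ i)))

m+[1+n]∸o<1+n : ∀ {m n o} → m < o → m + suc n ∸ o < suc n
m+[1+n]∸o<1+n {m} {n} m<o =
  s≤s (≤-trans (∸-monoʳ-≤ (m + suc n) m<o) (≤-reflexive (trans (cong (_∸ suc m) (+-suc m n)) (m+n∸m≡n m n))))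

⊛-shiftʳ : ∀ m (C H : Series) → C ⊛ shift (suc m) H ≗ shift (suc m) (C ⊛ H)
⊛-shiftʳ m C H r with shiftView (suc m) r
... | below r<m = trans (sumTo-zero r (λ {i} _ → vanishes (≤-<-trans (m∸n≤m r i) r<m)))
                        (sym (shift-below (C ⊛ H) r<m))
  where
  vanishes : ∀ {i} → r ∸ i < suc m → C i * shift (suc m) H (r ∸ i) ≡ 0
  vanishes {i} lt = trans (cong (C i *_) (shift-below H lt)) (*-zeroʳ (C i))
... | above t = begin
  sumTo (t + suc m) (λ i → C i * shift (suc m) H (t + suc m ∸ i))  ≡⟨ sumTo-vanishing-tail t tail-vanishes (suc m) ⟩
  sumTo t (λ i → C i * shift (suc m) H (t + suc m ∸ i))
    ≡⟨ sumTo-cong t (λ {i} i≤t → cong (C i *_) (unshift i≤t)) ⟩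
  (C ⊛ H) t                                                         ≡⟨ shift-above (suc m) t (C ⊛ H) ⟨
  shift (suc m) (C ⊛ H) (t + suc m)                                 ∎
  where
  open ≡-Reasoning
  tail-vanishes : ∀ {i} → t < i → C i * shift (suc m) H (t + suc m ∸ i) ≡ 0
  tail-vanishes {i} t<i = trans (cong (C i *_) (shift-below H (m+[1+n]∸o<1+n t<i))) (*-zeroʳ (C i))
  unshift : ∀ {i} → i ≤ t → shift (suc m) H (t + suc m ∸ i) ≡ H (t ∸ i)
  unshift {i} i≤t = trans (cong (shift (suc m) H) (+-∸-comm (suc m) i≤t)) (shift-above (suc m) (t ∸ i) H)

infix 4 _/[1-q^_]≗_

-- F = A / (1 - q^m), in the division-free form F = A + q^m F.
_/[1-q^_]≗_ : Series → ℕ → Series → Set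
A /[1-q^ m ]≗ F = F ≗ A ⊕ shift m F

quotient-congˡ : ∀ {m A B F} → A ≗ B → A /[1-q^ m ]≗ F → B /[1-q^ m ]≗ F
quotient-congˡ {m} {F = F} A≗B hF r = trans (hF r) (cong (_+ shift m F r) (A≗B r))

quotient-unique : ∀ {m A F G} → A /[1-q^ suc m ]≗ F → A /[1-q^ suc m ]≗ G → F ≗ G
quotient-unique {m} {A} {F} {G} hF hG = <-rec (λ r → F r ≡ G r) step
  where
  step : ∀ r → (∀ {t} → t < r → F t ≡ G t) → F r ≡ G r
  step r ih = trans (hF r) (trans (cong (A r +_) shifts-agree) (sym (hG r)))
    where
    shifts-agree : shift (suc m) F r ≡ shift (suc m) G r
    shifts-agree with shiftView (suc m) r
    ... | below r<m = trans (shift-below F r<m) (sym (shift-below G r<m))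
    ... | above t   = begin
      shift (suc m) F (t + suc m)  ≡⟨ shift-above (suc m) t F ⟩
      F t                          ≡⟨ ih (m<m+n t z<s) ⟩
      G t                          ≡⟨ shift-above (suc m) t G ⟨
      shift (suc m) G (t + suc m)  ∎
      where open ≡-Reasoning

quotient-shift : ∀ a {m A F} → A /[1-q^ m ]≗ F → shift a A /[1-q^ m ]≗ shift a F
quotient-shift a {m} {A} {F} hF r = begin
  shift a F r                          ≡⟨ shift-cong a hF r ⟩
  shift a (A ⊕ shift m F) r            ≡⟨ shift-distrib-⊕ a A (shift m F) r ⟩
  shift a A r + shift a (shift m F) r  ≡⟨ cong (shift a A r +_) (shift-comm a m F r) ⟩
  shift a A r + shift m (shift a F) r  ∎
  where open ≡-Reasoning

quotient-⊛ˡ : ∀ (C : Series) {m P H} → P /[1-q^ suc m ]≗ H → C ⊛ P /[1-q^ suc m ]≗ C ⊛ H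
quotient-⊛ˡ C {m} {P} {H} hH r = begin
  (C ⊛ H) r                               ≡⟨ ⊛-congˡ C hH r ⟩
  (C ⊛ (P ⊕ shift (suc m) H)) r           ≡⟨ ⊛-distribˡ-⊕ C P (shift (suc m) H) r ⟩
  (C ⊛ P) r + (C ⊛ shift (suc m) H) r     ≡⟨ cong ((C ⊛ P) r +_) (⊛-shiftʳ m C H r) ⟩
  (C ⊛ P) r + shift (suc m) (C ⊛ H) r     ∎
  where open ≡-Reasoning

geom-quotient : ∀ j → one /[1-q^ suc j ]≗ geom j
geom-quotient j r with shiftView (suc j) r
... | below r<k = begin
  geom j r        ≡⟨ cong (λ x → if x ≡ᵇ 0 then 1 else 0) (m<n⇒m%n≡m r<k) ⟩
  one r           ≡⟨ +-identityʳ (one r) ⟨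
  one r + 0       ≡⟨ cong (one r +_) (shift-below (geom j) r<k) ⟨
  one r + shift (suc j) (geom j) r ∎
  where open ≡-Reasoning
... | above t = begin
  geom j (t + suc j)                          ≡⟨ cong (λ x → if x ≡ᵇ 0 then 1 else 0) ([m+n]%n≡m%n t (suc j)) ⟩
  geom j t                                    ≡⟨ shift-above (suc j) t (geom j) ⟨
  shift (suc j) (geom j) (t + suc j)          ≡⟨ cong (λ n → one n + shift (suc j) (geom j) (t + suc j)) (+-suc t j) ⟨
  one (t + suc j) + shift (suc j) (geom j) (t + suc j) ∎
  where open ≡-Reasoning

⊛-geom-quotient : ∀ j (P : Series) → P /[1-q^ suc j ]≗ P ⊛ geom j
⊛-geom-quotient j P = quotient-congˡ {suc j} (⊛-identityʳ P) (quotient-⊛ˡ P (geom-quotient j))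

quotient-mono : ∀ {m A F} → A /[1-q^ m ]≗ F → ∀ t → F t ≤ F (t + m)
quotient-mono {m} {A} {F} hF t = begin
  F t                            ≤⟨ m≤n+m (F t) (A (t + m)) ⟩
  A (t + m) + F t                ≡⟨ cong (A (t + m) +_) (shift-above m t F) ⟨
  A (t + m) + shift m F (t + m)  ≡⟨ hF (t + m) ⟨
  F (t + m)                      ∎
  where open ≤-Reasoning

⊛-monoˡ-shift : ∀ m {C : Series} → (∀ t → C t ≤ C (t + m)) → ∀ (P : Series) t → (C ⊛ P) t ≤ (C ⊛ P) (t + m)
⊛-monoˡ-shift m {C} C-mono P t = begin
  sumTo t (λ i → C i * P (t ∸ i))                    ≤⟨ sumTo-mono t termwise ⟩
  sumTo t (λ i → C (i + m) * P (t + m ∸ (i + m)))    ≤⟨ sumTo-reindex-≤ m t (λ i → C i * P (t + m ∸ i)) ⟩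
  sumTo (t + m) (λ i → C i * P (t + m ∸ i))          ∎
  where
  open ≤-Reasoning
  termwise : ∀ i → C i * P (t ∸ i) ≤ C (i + m) * P (t + m ∸ (i + m))
  termwise i = *-mono-≤ (C-mono i) (≤-reflexive (cong P (sym
    (trans (cong₂ _∸_ (+-comm t m) (+-comm i m)) ([m+n]∸[m+o]≡n∸o m t i)))))

iterate-mono : ∀ m {F : Series} → (∀ t → F t ≤ F (t + m)) → ∀ e t → F t ≤ F (t + m * e)
iterate-mono m {F} step zero    t = ≤-reflexive (cong F (sym (trans (cong (t +_) (*-zeroʳ m)) (+-identityʳ t))))
iterate-mono m {F} step (suc e) t = begin
  F t              ≤⟨ iterate-mono m step e t ⟩
  F (t + m * e)    ≤⟨ step (t + m * e) ⟩
  F (t + m * e + m) ≡⟨ cong F (trans (+-assoc t (m * e) m) (cong (t +_) (trans (+-comm (m * e) m) (sym (*-suc m e))))) ⟩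
  F (t + m * suc e) ∎
  where open ≤-Reasoning

shift-antitone : ∀ a b {F : Series} → (∀ t → F t ≤ F (t + a)) → ∀ r → shift (a + b) F r ≤ shift b F r
shift-antitone a b {F} F-mono r with shiftView (a + b) r
... | below r<a+b = ≤-trans (≤-reflexive (shift-below F r<a+b)) z≤n
... | above t     = begin
  shift (a + b) F (t + (a + b))  ≡⟨ shift-above (a + b) t F ⟩
  F t                            ≤⟨ F-mono t ⟩
  F (t + a)                      ≡⟨ shift-above b (t + a) F ⟨
  shift b F (t + a + b)          ≡⟨ cong (shift b F) (+-assoc t a b) ⟩
  shift b F (t + (a + b))        ∎
  where open ≤-Reasoning

-- K_k = 1/((1 - q^k)^2 (1 - q^(k+1)) ⋯ (1 - q^(k+M))) with k = suc j.
kernel : ℕ → ℕ → Series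
kernel M j = (geom j ⊛ geom j) ⊛ prodGeom (suc j) M

prodGeom-zero : ∀ k M → prodGeom k M 0 ≡ 1
prodGeom-zero k zero    = refl
prodGeom-zero k (suc M) = cong (_* 1) (prodGeom-zero k M)

kernel-zero : ∀ M j → kernel M j 0 ≡ 1
kernel-zero M j = trans (+-identityʳ _) (prodGeom-zero (suc j) M)

kernel-mono : ∀ M j t → kernel M j t ≤ kernel M j (t + suc j * M)
kernel-mono M j = iterate-mono (suc j)
  (⊛-monoˡ-shift (suc j) (quotient-mono {suc j} (⊛-geom-quotient j (geom j))) (prodGeom (suc j) M)) M

sptMinusSummand-≤ : ∀ M j n → sptMinusSummand M (suc j) n ≤ shift (suc j) (kernel M j) n
sptMinusSummand-≤ M j = shift-antitone (suc j * M) (suc j) (kernel-mono M j)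

sumFrom1-zero : ∀ N {f : ℕ → ℕ} → (∀ {k} → 0 < k → k ≤ N → f k ≡ 0) → sumFrom1 N f ≡ 0
sumFrom1-zero zero    _   = refl
sumFrom1-zero (suc N) f≡0 = cong₂ _+_ (sumFrom1-zero N (λ 0<k k≤N → f≡0 0<k (m≤n⇒m≤1+n k≤N))) (f≡0 z<s ≤-refl)

sumFrom1-single : ∀ N {f : ℕ → ℕ} {s} → 0 < s → s ≤ N → (∀ {k} → k ≢ s → f k ≡ 0) → sumFrom1 N f ≡ f s
sumFrom1-single zero    0<s s≤0 _ = contradiction s≤0 (<⇒≱ 0<s)
sumFrom1-single (suc N) {f} {s} 0<s s≤1+N off-s with s ≟ suc N
... | yes refl = cong (_+ f (suc N)) (sumFrom1-zero N (λ _ k≤N → off-s (λ { refl → 1+n≰n k≤N })))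
... | no  s≢1+N = trans (cong₂ _+_ (sumFrom1-single N 0<s (≤-pred (≤∧≢⇒< s≤1+N s≢1+N)) off-s) (off-s (s≢1+N ∘ sym)))
                        (+-identityʳ (f s))

sumFrom1-distrib-+ : ∀ N (f g : ℕ → ℕ) → sumFrom1 N (λ k → f k + g k) ≡ sumFrom1 N f + sumFrom1 N g
sumFrom1-distrib-+ zero    f g = refl
sumFrom1-distrib-+ (suc N) f g =
  trans (cong (_+ (f (suc N) + g (suc N))) (sumFrom1-distrib-+ N f g)) (interchange (sumFrom1 N f) (sumFrom1 N g) _ _)

sumFrom1-mono : ∀ N {f g : ℕ → ℕ} → (∀ j → f (suc j) ≤ g (suc j)) → sumFrom1 N f ≤ sumFrom1 N g
sumFrom1-mono zero    _   = z≤n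
sumFrom1-mono (suc N) f≤g = +-mono-≤ (sumFrom1-mono N f≤g) (f≤g N)

sumFrom1-mono-< : ∀ N {f g : ℕ → ℕ} → (∀ j → f (suc j) ≤ g (suc j)) → f (suc N) < g (suc N) →
                  sumFrom1 (suc N) f < sumFrom1 (suc N) g
sumFrom1-mono-< N f≤g last< = +-mono-≤-< (sumFrom1-mono N f≤g) last<

sum-map-distrib-+ : ∀ {A : Set} (v w : A → ℕ) xs → sum (map (λ x → v x + w x) xs) ≡ sum (map v xs) + sum (map w xs)
sum-map-distrib-+ v w []       = refl
sum-map-distrib-+ v w (x ∷ xs) =
  trans (cong (v x + w x +_) (sum-map-distrib-+ v w xs)) (interchange (v x) (w x) _ _)

sum-map-zero : ∀ {A : Set} {w : A → ℕ} → (∀ x → w x ≡ 0) → ∀ xs → sum (map w xs) ≡ 0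
sum-map-zero w≡0 []       = refl
sum-map-zero w≡0 (x ∷ xs) = cong₂ _+_ (w≡0 x) (sum-map-zero w≡0 xs)

sum-map-sumFrom1 : ∀ {A : Set} N (f : ℕ → A → ℕ) xs →
  sum (map (λ x → sumFrom1 N (λ k → f k x)) xs) ≡ sumFrom1 N (λ k → sum (map (f k) xs))
sum-map-sumFrom1 N f []       = sym (sumFrom1-zero N (λ _ _ → refl))
sum-map-sumFrom1 N f (x ∷ xs) =
  trans (cong (sumFrom1 N (λ k → f k x) +_) (sum-map-sumFrom1 N f xs))
        (sym (sumFrom1-distrib-+ N (λ k → f k x) (λ k → sum (map (f k) xs))))

constant-between : ∀ {A : Set} (f : ℕ → A) {m n} → m ≤ n → (∀ {i} → m ≤ i → i < n → f (suc i) ≡ f i) → f n ≡ f m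
constant-between f {n = zero}  z≤n  _    = refl
constant-between f {n = suc n} m≤1+n step with m≤n⇒m<n∨m≡n m≤1+n
... | inj₂ refl  = refl
... | inj₁ m<1+n = trans (step (≤-pred m<1+n) ≤-refl)
                         (constant-between f (≤-pred m<1+n) (λ m≤i i<n → step m≤i (m<n⇒m<1+n i<n)))

-- Partitions

boundedPartitions : ℕ → ℕ → List (List ℕ)
boundedPartitions r m = partsGo (suc (r + m)) r m

partsGo-fuel : ∀ f f' r m → r + m < f → r + m < f' → partsGo f r m ≡ partsGo f' r m
partsGo-fuel (suc f) (suc f') zero    m       _ _ = refl
partsGo-fuel (suc f) (suc f') (suc n) zero    _ _ = refl
partsGo-fuel (suc f) (suc f') (suc n) (suc m) (s≤s r+m<f) (s≤s r+m<f') =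
  cong₂ _++_ (partsGo-fuel f f' (suc n) m (shrink r+m<f) (shrink r+m<f'))
             (cong (λ L → if suc m ≤ᵇ suc n then map (suc m ∷_) L else [])
                   (partsGo-fuel f f' (n ∸ m) (suc m) (remainder r+m<f) (remainder r+m<f')))
  where
  shrink : ∀ {g} → suc n + suc m ≤ g → suc n + m < g
  shrink = ≤-trans (≤-reflexive (sym (+-suc (suc n) m)))
  remainder : ∀ {g} → suc n + suc m ≤ g → n ∸ m + suc m < g
  remainder = ≤-trans (s≤s (+-monoˡ-≤ (suc m) (m∸n≤m n m)))

boundedPartitions-suc : ∀ n m →
  boundedPartitions (suc n) (suc m) ≡
  boundedPartitions (suc n) m ++ (if suc m ≤ᵇ suc n then map (suc m ∷_) (boundedPartitions (n ∸ m) (suc m)) else [])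
boundedPartitions-suc n m =
  cong₂ _++_ (partsGo-fuel (suc n + suc m) (suc (suc n + m)) (suc n) m (≤-reflexive (sym (+-suc (suc n) m))) ≤-refl)
             (cong (λ L → if suc m ≤ᵇ suc n then map (suc m ∷_) L else [])
                   (partsGo-fuel (suc n + suc m) (suc (n ∸ m + suc m)) (n ∸ m) (suc m)
                                 (s≤s (+-monoˡ-≤ (suc m) (m∸n≤m n m))) ≤-refl))

ΣParts : (List ℕ → ℕ) → ℕ → Series
ΣParts w m r = sum (map w (boundedPartitions r m))

ΣParts-cong : ∀ {v w : List ℕ → ℕ} → v ≗ w → ∀ m → ΣParts v m ≗ ΣParts w m
ΣParts-cong v≗w m r = cong sum (map-cong v≗w (boundedPartitions r m))

ΣParts-distrib-+ : ∀ (v w : List ℕ → ℕ) m → ΣParts (λ l → v l + w l) m ≗ ΣParts v m ⊕ ΣParts w m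
ΣParts-distrib-+ v w m r = sum-map-distrib-+ v w (boundedPartitions r m)

-- Split off the partitions whose largest part is exactly m + 1.
ΣParts-suc : ∀ w m → ΣParts w (suc m) ≗ ΣParts w m ⊕ shift (suc m) (ΣParts (w ∘ (suc m ∷_)) (suc m))
ΣParts-suc w m zero    = sym (+-identityʳ _)
ΣParts-suc w m (suc n) = begin
  ΣParts w (suc m) (suc n)                 ≡⟨ cong (sum ∘ map w) (boundedPartitions-suc n m) ⟩
  sum (map w (P ++ Q))                     ≡⟨ cong sum (map-++ w P Q) ⟩
  sum (map w P ++ map w Q)                 ≡⟨ sum-++ (map w P) (map w Q) ⟩
  sum (map w P) + sum (map w Q)            ≡⟨ cong (sum (map w P) +_) (if-float (sum ∘ map w) (suc m ≤ᵇ suc n)) ⟩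
  sum (map w P) + (if suc m ≤ᵇ suc n then sum (map w (map (suc m ∷_) L)) else 0)
    ≡⟨ cong (λ x → sum (map w P) + (if suc m ≤ᵇ suc n then x else 0)) (cong sum (sym (map-∘ L))) ⟩
  ΣParts w m (suc n) + shift (suc m) (ΣParts (w ∘ (suc m ∷_)) (suc m)) (suc n) ∎
  where
  open ≡-Reasoning
  P = boundedPartitions (suc n) m
  L = boundedPartitions (n ∸ m) (suc m)
  Q = if suc m ≤ᵇ suc n then map (suc m ∷_) L else []

ΣParts-quotient : ∀ {w} m → (∀ l → w (suc m ∷ l) ≡ w l) → ΣParts w m /[1-q^ suc m ]≗ ΣParts w (suc m)
ΣParts-quotient {w} m head-invisible r =
  trans (ΣParts-suc w m r) (cong (ΣParts w m r +_) (shift-cong (suc m) (ΣParts-cong head-invisible (suc m)) r))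

ΣParts-step : ∀ w m r → shift (suc m) (ΣParts (w ∘ (suc m ∷_)) (suc m)) r ≡ 0 → ΣParts w (suc m) r ≡ ΣParts w m r
ΣParts-step w m r no-new-parts =
  trans (ΣParts-suc w m r) (trans (cong (ΣParts w m r +_) no-new-parts) (+-identityʳ (ΣParts w m r)))

ΣParts-vanishing-heads : ∀ {w m n} → m ≤ n → (∀ {x} l → m < x → x ≤ n → w (x ∷ l) ≡ 0) → ΣParts w n ≗ ΣParts w m
ΣParts-vanishing-heads {w} m≤n vanishes r = constant-between (λ i → ΣParts w i r) m≤n λ {i} m≤i i<n →
  ΣParts-step w i r (shift-zero (suc i) (λ t → sum-map-zero (λ l → vanishes l (s≤s m≤i) i<n) (boundedPartitions t (suc i)))
                                r)

ΣParts-beyond : ∀ w {r m n} → r ≤ m → m ≤ n → ΣParts w n r ≡ ΣParts w m r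
ΣParts-beyond w {r} r≤m m≤n = constant-between (λ i → ΣParts w i r) m≤n λ {i} m≤i _ →
  ΣParts-step w i r (shift-below (ΣParts (w ∘ (suc i ∷_)) (suc i)) (s≤s (≤-trans r≤m m≤i)))

data Partition≤ : ℕ → List ℕ → Set where
  []   : ∀ {m} → Partition≤ m []
  cons : ∀ {m x l} → 0 < x → x ≤ m → Partition≤ x l → Partition≤ m (x ∷ l)

Partition≤-weaken : ∀ {m m' l} → m ≤ m' → Partition≤ m l → Partition≤ m' l
Partition≤-weaken m≤m' []              = []
Partition≤-weaken m≤m' (cons 0<x x≤m p) = cons 0<x (≤-trans x≤m m≤m') p

partsGo-Partition≤ : ∀ f n m → All (Partition≤ m) (partsGo f n m)
partsGo-Partition≤ zero    n       m       = []
partsGo-Partition≤ (suc f) zero    m       = [] ∷ []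
partsGo-Partition≤ (suc f) (suc n) zero    = []
partsGo-Partition≤ (suc f) (suc n) (suc m) =
  ++⁺ (All.map (Partition≤-weaken (n≤1+n m)) (partsGo-Partition≤ f (suc n) m)) (with-head (suc m ≤ᵇ suc n))
  where
  with-head : ∀ b → All (Partition≤ (suc m)) (if b then map (suc m ∷_) (partsGo f (n ∸ m) (suc m)) else [])
  with-head true  = map⁺ (All.map (cons z<s ≤-refl) (partsGo-Partition≤ f (n ∸ m) (suc m)))
  with-head false = []

Partition≤-bounded : ∀ {m l} → Partition≤ m l → All (λ x → 0 < x × x ≤ m) l
Partition≤-bounded []               = []
Partition≤-bounded (cons 0<x x≤m p) = (0<x , x≤m) ∷ All.map (map₂ (λ y≤x → ≤-trans y≤x x≤m)) (Partition≤-bounded p)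

smallest-minimal : ∀ {m l} → Partition≤ m l → All (smallest l ≤_) l
smallest-minimal []                              = []
smallest-minimal (cons _ _ [])                   = ≤-refl ∷ []
smallest-minimal (cons _ _ p@(cons _ y≤x _)) with smallest-minimal p
... | s≤y ∷ s≤ys = ≤-trans s≤y y≤x ∷ s≤y ∷ s≤ys

All-smallest : ∀ {P : ℕ → Set} {x l} → All P (x ∷ l) → P (smallest (x ∷ l))
All-smallest (px ∷ [])          = px
All-smallest (_ ∷ pys@(_ ∷ _)) = All-smallest pys

head-maximal : ∀ {m x l} → Partition≤ m (x ∷ l) → All (_≤ x) (x ∷ l)
head-maximal (cons _ _ p) = ≤-refl ∷ All.map proj₂ (Partition≤-bounded p)

-- Grouping by the smallest part

inRange : ℕ → ℕ → ℕ → Bool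
inRange M k x = (k ≤ᵇ x) ∧ (x ≤ᵇ k + M)

admissible : ℕ → ℕ → List ℕ → Bool
admissible M k = all (inRange M k)

-- Contribution to spt*_M of a partition whose smallest part is k: all parts must lie in [k, k + M].
weight : ℕ → ℕ → List ℕ → ℕ
weight M k l = if admissible M k l then count k l else 0

indicator : ℕ → ℕ → List ℕ → ℕ
indicator M k l = if admissible M k l then 1 else 0

admissible-sound : ∀ {M k} l → T (admissible M k l) → All (λ x → k ≤ x × x ≤ k + M) l
admissible-sound {M} {k} l adm = All.map inRange-sound (all⁺ (inRange M k) l adm)
  where
  inRange-sound : ∀ {x} → T (inRange M k x) → k ≤ x × x ≤ k + M
  inRange-sound {x} t with Equivalence.to T-∧ t
  ... | k≤ᵇx , x≤ᵇk+M = ≤ᵇ⇒≤ k x k≤ᵇx , ≤ᵇ⇒≤ x (k + M) x≤ᵇk+M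

admissible-complete : ∀ {M k l} → All (λ x → k ≤ x × x ≤ k + M) l → T (admissible M k l)
admissible-complete {M} {k} in-range =
  all⁻ (inRange M k) (All.map (λ (k≤x , x≤k+M) → Equivalence.from T-∧ (≤⇒≤ᵇ k≤x , ≤⇒≤ᵇ x≤k+M)) in-range)

admissible-∷-inside : ∀ {M k x} l → k ≤ x → x ≤ k + M → admissible M k (x ∷ l) ≡ admissible M k l
admissible-∷-inside {M} {k} l k≤x x≤k+M = cong (_∧ admissible M k l) (cong₂ _∧_ (≤ᵇ-true k≤x) (≤ᵇ-true x≤k+M))

admissible-∷-below : ∀ {M k x} l → x < k → admissible M k (x ∷ l) ≡ false
admissible-∷-below {M} {k} {x} l x<k = cong (λ b → (b ∧ (x ≤ᵇ k + M)) ∧ admissible M k l) (≤ᵇ-false x<k)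

admissible-∷-above : ∀ {M k x} l → k + M < x → admissible M k (x ∷ l) ≡ false
admissible-∷-above {M} {k} {x} l k+M<x =
  cong (_∧ admissible M k l) (trans (cong ((k ≤ᵇ x) ∧_) (≤ᵇ-false k+M<x)) (∧-zeroʳ (k ≤ᵇ x)))

weight-∷-inside : ∀ {M k x} l → k < x → x ≤ k + M → weight M k (x ∷ l) ≡ weight M k l
weight-∷-inside {M} {k} {x} l k<x x≤k+M =
  cong₂ (λ a c → if a then (if c then 1 else 0) + count k l else 0)
        (admissible-∷-inside l (<⇒≤ k<x) x≤k+M) (≡ᵇ-false (<⇒≢ k<x))

weight-∷-self : ∀ {M k} l → weight M k (k ∷ l) ≡ indicator M k l + weight M k l
weight-∷-self {M} {k} l =
  trans (cong₂ (λ a c → if a then (if c then 1 else 0) + count k l else 0)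
               (admissible-∷-inside l ≤-refl (m≤m+n k M)) (≡ᵇ-refl k))
        (if-distrib-+ (admissible M k l))

indicator-∷-self : ∀ {M k} l → indicator M k (k ∷ l) ≡ indicator M k l
indicator-∷-self {M} {k} l = cong (λ a → if a then 1 else 0) (admissible-∷-inside l ≤-refl (m≤m+n k M))

-- Admitting the parts k, k + 1, …, k + M one at a time, each new part m divides the generating
-- function by 1 - q^m; the part k also raises the count, which produces the second factor 1/(1 - q^k).
module _ (M j : ℕ) where
  private
    k = suc j
    S : ℕ → Series
    S d = shift k ((geom j ⊛ geom j) ⊛ prodGeom k d)

  ΣParts-indicator-below : ΣParts (indicator M k) j ≗ one
  ΣParts-indicator-below r = trans (ΣParts-vanishing-heads z≤n vanishes r) (ΣParts-indicator-zero r)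
    where
    vanishes : ∀ {x} l → 0 < x → x ≤ j → indicator M k (x ∷ l) ≡ 0
    vanishes l _ x≤j = cong (λ a → if a then 1 else 0) (admissible-∷-below l (s≤s x≤j))
    ΣParts-indicator-zero : ΣParts (indicator M k) 0 ≗ one
    ΣParts-indicator-zero zero    = refl
    ΣParts-indicator-zero (suc r) = refl

  ΣParts-weight-below : ∀ r → ΣParts (weight M k) j r ≡ 0
  ΣParts-weight-below r = trans (ΣParts-vanishing-heads z≤n vanishes r) (ΣParts-weight-zero r)
    where
    vanishes : ∀ {x} l → 0 < x → x ≤ j → weight M k (x ∷ l) ≡ 0
    vanishes {x} l _ x≤j = cong (λ a → if a then count k (x ∷ l) else 0) (admissible-∷-below l (s≤s x≤j))
    ΣParts-weight-zero : ∀ r → ΣParts (weight M k) 0 r ≡ 0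
    ΣParts-weight-zero zero    = refl
    ΣParts-weight-zero (suc r) = refl

  ΣParts-indicator-self : ΣParts (indicator M k) k ≗ geom j
  ΣParts-indicator-self = quotient-unique {j}
    (quotient-congˡ {k} ΣParts-indicator-below (ΣParts-quotient j indicator-∷-self))
    (geom-quotient j)

  ΣParts-weight-self : ΣParts (weight M k) k ≗ shift k (geom j ⊛ geom j)
  ΣParts-weight-self = quotient-unique {j} weight-quotient (quotient-shift k {k} (⊛-geom-quotient j (geom j)))
    where
    W = ΣParts (weight M k) k
    I = ΣParts (indicator M k) k
    split-count : ΣParts (weight M k ∘ (k ∷_)) k ≗ I ⊕ W
    split-count t = trans (ΣParts-cong (weight-∷-self {M} {k}) k t) (ΣParts-distrib-+ (indicator M k) (weight M k) k t)
    weight-quotient : shift k (geom j) /[1-q^ k ]≗ W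
    weight-quotient r = begin
      W r                                                                    ≡⟨ ΣParts-suc (weight M k) j r ⟩
      ΣParts (weight M k) j r + shift k (ΣParts (weight M k ∘ (k ∷_)) k) r
        ≡⟨ cong₂ _+_ (ΣParts-weight-below r) (shift-cong k split-count r) ⟩
      shift k (I ⊕ W) r                                                      ≡⟨ shift-distrib-⊕ k I W r ⟩
      shift k I r + shift k W r
        ≡⟨ cong (_+ shift k W r) (shift-cong k ΣParts-indicator-self r) ⟩
      shift k (geom j) r + shift k W r                                       ∎
      where open ≡-Reasoning

  ΣParts-weight-upto : ∀ d → d ≤ M → ΣParts (weight M k) (k + d) ≗ S d
  ΣParts-weight-upto zero    _   r = begin
    ΣParts (weight M k) (k + 0) r        ≡⟨ cong (λ m → ΣParts (weight M k) m r) (+-identityʳ k) ⟩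
    ΣParts (weight M k) k r              ≡⟨ ΣParts-weight-self r ⟩
    shift k (geom j ⊛ geom j) r          ≡⟨ shift-cong k (⊛-identityʳ (geom j ⊛ geom j)) r ⟨
    shift k ((geom j ⊛ geom j) ⊛ one) r  ∎
    where open ≡-Reasoning
  ΣParts-weight-upto (suc d) d<M r = begin
    ΣParts (weight M k) (k + suc d) r    ≡⟨ cong (λ m → ΣParts (weight M k) m r) (+-suc k d) ⟩
    ΣParts (weight M k) (suc (k + d)) r  ≡⟨ quotient-unique {k + d} ΣParts-quotient-S S-quotient r ⟩
    S (suc d) r                          ∎
    where
    open ≡-Reasoning
    k+d<k+M : suc (k + d) ≤ k + M
    k+d<k+M = ≤-trans (≤-reflexive (sym (+-suc k d))) (+-monoʳ-≤ k d<M)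
    ΣParts-quotient-S : S d /[1-q^ suc (k + d) ]≗ ΣParts (weight M k) (suc (k + d))
    ΣParts-quotient-S = quotient-congˡ {suc (k + d)} (ΣParts-weight-upto d (<⇒≤ d<M))
      (ΣParts-quotient (k + d) (λ l → weight-∷-inside l (s≤s (m≤m+n k d)) k+d<k+M))
    S-quotient : S d /[1-q^ suc (k + d) ]≗ S (suc d)
    S-quotient = quotient-shift k {suc (k + d)} (quotient-⊛ˡ (geom j ⊛ geom j) (⊛-geom-quotient (k + d) (prodGeom k d)))

  ΣParts-weight : ∀ n → ΣParts (weight M k) n n ≡ shift k (kernel M j) n
  ΣParts-weight n with ≤-total n (k + M)
  ... | inj₁ n≤k+M = trans (sym (ΣParts-beyond (weight M k) ≤-refl n≤k+M)) (ΣParts-weight-upto M ≤-refl n)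
  ... | inj₂ k+M≤n = trans (ΣParts-vanishing-heads k+M≤n vanishes n) (ΣParts-weight-upto M ≤-refl n)
    where
    vanishes : ∀ {x} l → k + M < x → x ≤ n → weight M k (x ∷ l) ≡ 0
    vanishes {x} l k+M<x _ = cong (λ a → if a then count k (x ∷ l) else 0) (admissible-∷-above l k+M<x)

count-absent : ∀ {k l} → All (k ≢_) l → count k l ≡ 0
count-absent []             = refl
count-absent (k≢x ∷ k∉l) = cong₂ _+_ (cong (λ b → if b then 1 else 0) (≡ᵇ-false k≢x)) (count-absent k∉l)

weight-off-smallest : ∀ M {N x l} → Partition≤ N (x ∷ l) → ∀ {k} → k ≢ smallest (x ∷ l) → weight M k (x ∷ l) ≡ 0
weight-off-smallest M {x = x} {l} p {k} k≢s with <-cmp k (smallest (x ∷ l))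
... | tri< k<s _ _ = if-then-zero (admissible M k (x ∷ l))
                       (count-absent (All.map (λ s≤y → <⇒≢ (<-≤-trans k<s s≤y)) (smallest-minimal p)))
... | tri≈ _ k≡s _ = contradiction k≡s k≢s
... | tri> _ _ s<k = cong (λ a → if a then count k (x ∷ l) else 0) (¬-not not-admissible)
  where
  not-admissible : admissible M k (x ∷ l) ≢ true
  not-admissible adm = <⇒≱ s<k (proj₁ (All-smallest (admissible-sound (x ∷ l) (Equivalence.from T-≡ adm))))

weight-smallest : ∀ M {N x l} → Partition≤ N (x ∷ l) → weight M (smallest (x ∷ l)) (x ∷ l) ≡ sptStarTerm M (x ∷ l)
weight-smallest M {x = x} {l} p = cong (λ a → if a then count s (x ∷ l) else 0)
  (det (fromEquivalence sound complete) (≤ᵇ-reflects-≤ x (s + M)))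
  where
  s = smallest (x ∷ l)
  sound : T (admissible M s (x ∷ l)) → x ≤ s + M
  sound adm = proj₂ (All.head (admissible-sound {M} {s} (x ∷ l) adm))
  complete : x ≤ s + M → T (admissible M s (x ∷ l))
  complete x≤s+M =
    admissible-complete (All.zip (smallest-minimal p , All.map (λ y≤x → ≤-trans y≤x x≤s+M) (head-maximal p)))

sptStarTerm-as-sum : ∀ M {N l} → Partition≤ N l → sptStarTerm M l ≡ sumFrom1 N (λ k → weight M k l)
sptStarTerm-as-sum M {N} []                  = sym (sumFrom1-zero N (λ _ _ → refl))
sptStarTerm-as-sum M {N} {x ∷ l} p@(cons _ _ _) = sym (begin
  sumFrom1 N (λ k → weight M k (x ∷ l))  ≡⟨ sumFrom1-single N 0<s s≤N (weight-off-smallest M p) ⟩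
  weight M (smallest (x ∷ l)) (x ∷ l)    ≡⟨ weight-smallest M p ⟩
  sptStarTerm M (x ∷ l)                  ∎)
  where
  open ≡-Reasoning
  0<s = proj₁ (All-smallest (Partition≤-bounded p))
  s≤N = proj₂ (All-smallest (Partition≤-bounded p))

sptStar-as-sum : ∀ M n → sptStar M n ≡ sumFrom1 n (λ k → ΣParts (weight M k) n n)
sptStar-as-sum M n =
  trans (cong sum (map-cong-local (All.map (sptStarTerm-as-sum M) (partsGo-Partition≤ (suc (n + n)) n n))))
        (sum-map-sumFrom1 n (weight M) (partitions n))

theorem3p2 : (n M : ℕ) → n > 0 → M > 0 → sptStar M n > sptMinus M n
theorem3p2 (suc n) (suc M) _ _ = begin-strict
  sptMinus (suc M) (suc n)                                             <⟨ sumFrom1-mono-< n termwise diagonal ⟩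
  sumFrom1 (suc n) (λ k → ΣParts (weight (suc M) k) (suc n) (suc n))  ≡⟨ sptStar-as-sum (suc M) (suc n) ⟨
  sptStar (suc M) (suc n)                                              ∎
  where
  open ≤-Reasoning
  termwise : ∀ j → sptMinusSummand (suc M) (suc j) (suc n) ≤ ΣParts (weight (suc M) (suc j)) (suc n) (suc n)
  termwise j = ≤-trans (sptMinusSummand-≤ (suc M) j (suc n)) (≤-reflexive (sym (ΣParts-weight (suc M) j (suc n))))
  diagonal : sptMinusSummand (suc M) (suc n) (suc n) < ΣParts (weight (suc M) (suc n)) (suc n) (suc n)
  diagonal = begin-strict
    sptMinusSummand (suc M) (suc n) (suc n)    ≡⟨ shift-below (kernel (suc M) n) (m<n+m (suc n) {suc n * suc M} z<s) ⟩
    0                                          <⟨ z<s ⟩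
    1                                          ≡⟨ kernel-zero (suc M) n ⟨
    kernel (suc M) n 0                         ≡⟨ shift-above (suc n) 0 (kernel (suc M) n) ⟨
    shift (suc n) (kernel (suc M) n) (suc n)   ≡⟨ ΣParts-weight (suc M) n (suc n) ⟨
    ΣParts (weight (suc M) (suc n)) (suc n) (suc n) ∎
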